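{- Let $r\geq 3$ be an integer and let $G$ be a finite simple $K_{1,r}$-free graph. If $\delta(G)\geq \left\lceil\frac{r}{2}\right\rceil+1$, then $G$ is a $\{P_2,P_3\}$-factor covered graph, i.e., for every edge $e\in E(G)$ there is a $\{P_2,P_3\}$-factor of $G$ containing $e$.
   Context: All graphs are finite and simple. $\delta(G)$ is the minimum degree of $G$. $K_{1,r}$ denotes the star with one center vertex adjacent to $r$ leaves; $G$ is $K_{1,r}$-free if it contains no induced subgraph isomorphic to $K_{1,r}$. $P_k$ denotes the path on $k$ vertices. A $\{P_2,P_3\}$-factor of $G$ is a spanning subgraph of $G$ each of whose connected components is isomorphic to $P_2$ or $P_3$. $G$ is a $\{P_2,P_3\}$-factor covered graph if for every $e\in E(G)$ there is a $\{P_2,P_3\}$-factor of $G$ whose edge set contains $e$. -}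

module Defs where

open import Data.Nat using (ℕ; _≤_; _+_; ⌈_/2⌉)
open import Data.Fin using (Fin)
open import Data.Bool using (Bool; true; false; T)
open import Data.List using (List; []; _∷_; length; filterᵇ; concatMap)
open import Data.List.Membership.Propositional using (_∈_)
open import Data.List.Relation.Binary.Permutation.Propositional using (_↭_)
open import Data.Fin.Base using ()
open import Data.List using (allFin)
open import Data.Product using (Σ; ∃; _×_; _,_)
open import Data.Sum using (_⊎_)
open import Relation.Binary.PropositionalEquality using (_≡_; _≢_)
open import Relation.Nullary using (¬_)
open import Function.Definitions using (Injective)

record Graph (n : ℕ) : Set where
  field
    adj   : Fin n → Fin n → Bool
    sym   : ∀ u v → adj u v ≡ adj v u
    irrefl : ∀ v → adj v v ≡ false

open Graph public

Adj : ∀ {n} → Graph n → Fin n → Fin n → Set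
Adj G u v = T (adj G u v)

degree : ∀ {n} → Graph n → Fin n → ℕ
degree {n} G v = length (filterᵇ (adj G v) (allFin n))

MinDegreeAtLeast : ∀ {n} → Graph n → ℕ → Set
MinDegreeAtLeast G k = ∀ v → k ≤ degree G v

HasInducedStar : ∀ {n} → Graph n → ℕ → Set
HasInducedStar {n} G r =
  Σ (Fin n) λ c → Σ (Fin r → Fin n) λ leaf →
    Injective _≡_ _≡_ leaf ×
    (∀ i → Adj G c (leaf i)) ×
    (∀ i j → ¬ Adj G (leaf i) (leaf j))

K1r-free : ∀ {n} → Graph n → ℕ → Set
K1r-free G r = ¬ HasInducedStar G r

data Piece (n : ℕ) : Set where
  p2 : Fin n → Fin n → Piece n
  p3 : Fin n → Fin n → Fin n → Piece n

verts : ∀ {n} → Piece n → List (Fin n)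
verts (p2 a b)   = a ∷ b ∷ []
verts (p3 a b c) = a ∷ b ∷ c ∷ []

PieceInG : ∀ {n} → Graph n → Piece n → Set
PieceInG G (p2 a b)   = Adj G a b
PieceInG G (p3 a b c) = Adj G a b × Adj G b c

UEdge : ∀ {n} → Fin n → Fin n → Fin n → Fin n → Set
UEdge x y a b = (x ≡ a × y ≡ b) ⊎ (x ≡ b × y ≡ a)

PieceHasEdge : ∀ {n} → Piece n → Fin n → Fin n → Set
PieceHasEdge (p2 a b)   x y = UEdge x y a b
PieceHasEdge (p3 a b c) x y = UEdge x y a b ⊎ UEdge x y b c

-- A {P2,P3}-factor of G: a list of vertex-disjoint P2/P3 paths whose edges
-- lie in G and which together cover every vertex exactly once
-- (the concatenated vertex lists are a permutation of all vertices).
record P23Factor {n : ℕ} (G : Graph n) : Set where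
  field
    pieces  : List (Piece n)
    inG     : ∀ {p} → p ∈ pieces → PieceInG G p
    spanning : concatMap verts pieces ↭ allFin n

open P23Factor public

FactorContains : ∀ {n} {G : Graph n} → P23Factor G → Fin n → Fin n → Set
FactorContains F x y = ∃ λ p → p ∈ pieces F × PieceHasEdge p x y

P23FactorCovered : ∀ {n} → Graph n → Set
P23FactorCovered G = ∀ x y → Adj G x y → ∃ λ (F : P23Factor G) → FactorContains F x y

-- Grow a partial {P₂,P₃}-factor that always contains the edge e = xy, starting from the P₂ on e.
-- An uncovered vertex is covered as soon as some vertex reachable from an uncovered vertex by
-- exchanges (an uncovered neighbour of the middle of a P₃ takes the place of one of its ends,
-- which becomes uncovered) is adjacent to a vertex that is uncovered, on a P₂ or an end of a P₃;
-- a P₃ through e is locked so that its end on e is never exchanged away. If this is impossible,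
-- let D be the set of reachable vertices and A = N(D). D is independent, so K_{1,r}-freeness and
-- double counting give (⌈r/2⌉+1)|D| ≤ (r−1)|A|. Every vertex of A is the middle of a P₃ whose
-- free ends lie in D, or locked, so 2|A| ≤ |D| + 2; with |A| ≥ δ(G) ≥ ⌈r/2⌉+1 this is absurd.

module Submission where

open import Data.Bool using (Bool; true; false; T; _∧_; _∨_; if_then_else_)
open import Data.Bool.Properties using (T-∧; T-∨)
open import Data.Empty using (⊥; ⊥-elim)
open import Data.Fin using (Fin; zero; suc) renaming (_<_ to _<ᶠ_)
open import Data.Fin.Properties using (suc-injective; any?)
  renaming (_≟_ to _≟ᶠ_; _<?_ to _<ᶠ?_; <-asym to <-asymᶠ; <-cmp to <-cmpᶠ)
open import Data.List using (List; []; _∷_; _++_; map; concatMap; length; filterᵇ; tabulate; allFin)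
open import Data.List.Properties using (concatMap-++)
open import Data.List.Membership.Propositional using (_∈_; _∉_; lose; find)
open import Data.List.Membership.Propositional.Properties using (∈-allFin; ∈-concatMap⁺; ∈-concatMap⁻)
open import Data.List.Membership.Propositional.Properties.WithK using (unique∧set⇒bag)
open import Data.List.Relation.Binary.BagAndSetEquality using (∼bag⇒↭)
open import Data.List.Relation.Binary.Disjoint.Propositional using (Disjoint)
open import Data.List.Relation.Binary.Permutation.Propositional using (_↭_)
open import Data.List.Relation.Unary.All as All using (All; []; _∷_)
import Data.List.Relation.Unary.All.Properties as All
open import Data.List.Relation.Unary.AllPairs as AllPairs using ([]; _∷_)
import Data.List.Relation.Unary.AllPairs.Properties as AllPairs
open import Data.List.Relation.Unary.Any using (here; there)
open import Data.List.Relation.Unary.Unique.Propositional using (Unique)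
open import Data.List.Relation.Unary.Unique.Propositional.Properties using (concat⁺; allFin⁺)
open import Data.Nat using (ℕ; zero; suc; pred; _+_; _*_; _≤_; _<_; _≤?_; z≤n; s≤s; ⌈_/2⌉)
open import Data.Nat.Properties hiding (suc-injective)
open import Data.Nat.Tactic.RingSolver using (solve-∀)
open import Data.Product using (Σ; ∃; _×_; _,_; proj₁; proj₂)
open import Data.Sum using (_⊎_; inj₁; inj₂)
open import Data.Unit using (⊤)
open import Function using (_∘_; _$_; id)
open import Function.Bundles using (Equivalence; mk⇔)
open import Function.Definitions using (Injective)
open import Relation.Binary.Definitions using (tri<; tri≈; tri>)
open import Relation.Binary.PropositionalEquality
open import Relation.Nullary using (¬_; Dec; yes; no; does)
open import Relation.Nullary.Decidable
  using (dec-true; dec-false; _×-dec_; _⊎-dec_; T?; ¬?; map′; decidable-stable; toWitness; fromWitness; ⌊_⌋)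

open import Defs renaming (sym to adj-symmetric)

open import Algebra.Properties.Semiring.Sum +-*-semiring
  using (sum; ∑-comm; *-distribˡ-sum; ∑-distrib-+; sum-cong-≗)

-- Counting

indicator : Bool → ℕ
indicator b = if b then 1 else 0

count : ∀ {n} → (Fin n → Bool) → ℕ
count p = sum (indicator ∘ p)

∑-mono-≤ : ∀ {n} {f g : Fin n → ℕ} → (∀ i → f i ≤ g i) → sum f ≤ sum g
∑-mono-≤ {zero}  f≤g = z≤n
∑-mono-≤ {suc n} f≤g = +-mono-≤ (f≤g zero) (∑-mono-≤ (f≤g ∘ suc))

indicator-mono : ∀ {a b} → (T a → T b) → indicator a ≤ indicator b
indicator-mono {false}         _   = z≤n
indicator-mono {true}  {true}  _   = ≤-refl
indicator-mono {true}  {false} a⇒b = ⊥-elim (a⇒b _)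

count-mono : ∀ {n} {p q : Fin n → Bool} → (∀ i → T (p i) → T (q i)) → count p ≤ count q
count-mono p⇒q = ∑-mono-≤ (λ i → indicator-mono (p⇒q i))

count-mono-< : ∀ {n} {p q : Fin n → Bool} → (∀ i → T (p i) → T (q i)) →
               ∀ j → T (q j) → ¬ T (p j) → count p < count q
count-mono-< {suc n} {p} {q} p⇒q zero qj ¬pj with p zero | q zero
... | true  | _     = ⊥-elim (¬pj _)
... | false | false = ⊥-elim qj
... | false | true  = s≤s (count-mono (p⇒q ∘ suc))
count-mono-< {suc n} {p} {q} p⇒q (suc j) qj ¬pj =
  ≤-trans (≤-reflexive (sym (+-suc (indicator (p zero)) _)))
          (+-mono-≤ (indicator-mono (p⇒q zero)) (count-mono-< (p⇒q ∘ suc) j qj ¬pj))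

count≤n : ∀ {n} (p : Fin n → Bool) → count p ≤ n
count≤n {zero}  p = z≤n
count≤n {suc n} p = +-mono-≤ (indicator-mono {b = true} _) (count≤n (p ∘ suc))

count-none : ∀ {n} (p : Fin n → Bool) → (∀ i → ¬ T (p i)) → count p ≡ 0
count-none {zero}  p none = refl
count-none {suc n} p none with p zero | none zero
... | true  | ¬p0 = ⊥-elim (¬p0 _)
... | false | _   = count-none (p ∘ suc) (none ∘ suc)

T⇒0<count : ∀ {n} (p : Fin n → Bool) {i} → T (p i) → 0 < count p
T⇒0<count p {zero} p0 with p zero
... | true = s≤s z≤n
T⇒0<count p {suc i} pi = ≤-trans (T⇒0<count (p ∘ suc) pi) (m≤n+m _ (indicator (p zero)))

T²⇒1<count : ∀ {n} (p : Fin n → Bool) {i j} → i ≢ j → T (p i) → T (p j) → 1 < count p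
T²⇒1<count p {zero}  {zero}  0≢0 _  _  = ⊥-elim (0≢0 refl)
T²⇒1<count p {zero}  {suc j} _   p0 pj with p zero
... | true = s≤s (T⇒0<count (p ∘ suc) pj)
T²⇒1<count p {suc i} {zero}  _   pi p0 with p zero
... | true = s≤s (T⇒0<count (p ∘ suc) pi)
T²⇒1<count p {suc i} {suc j} i≢j pi pj =
  ≤-trans (T²⇒1<count (p ∘ suc) (i≢j ∘ cong suc) pi pj) (m≤n+m _ (indicator (p zero)))

unique⇒count≤1 : ∀ {n} (p : Fin n → Bool) → (∀ i j → T (p i) → T (p j) → i ≡ j) → count p ≤ 1
unique⇒count≤1 {zero}  p unique = z≤n
unique⇒count≤1 {suc n} p unique with p zero in p0
... | true  = ≤-reflexive (cong suc (count-none (p ∘ suc) λ i pi →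
                0≢suc (unique zero (suc i) (subst T (sym p0) _) pi)))
  where
  0≢suc : ∀ {i : Fin n} → zero ≢ suc i
  0≢suc ()
... | false = unique⇒count≤1 (p ∘ suc) λ i j pi pj → suc-injective (unique (suc i) (suc j) pi pj)

count-cong : ∀ {n} {p q : Fin n → Bool} → (∀ i → p i ≡ q i) → count p ≡ count q
count-cong p≗q = sum-cong-≗ (cong indicator ∘ p≗q)

count-update : ∀ {n} (p q : Fin n → Bool) j → (∀ i → i ≢ j → p i ≡ q i) →
               count p + indicator (q j) ≡ count q + indicator (p j)
count-update {suc n} p q zero agree
  rewrite count-cong {p = p ∘ suc} {q = q ∘ suc} (λ i → agree (suc i) λ ())
  = swap-outer (indicator (p zero)) (count (q ∘ suc)) (indicator (q zero))
  where
  swap-outer : ∀ a c b → a + c + b ≡ b + c + a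
  swap-outer = solve-∀
count-update {suc n} p q (suc j) agree
  rewrite agree zero (λ ())
        | +-assoc (indicator (q zero)) (count (p ∘ suc)) (indicator (q (suc j)))
        | +-assoc (indicator (q zero)) (count (q ∘ suc)) (indicator (p (suc j)))
  = cong (indicator (q zero) +_)
         (count-update (p ∘ suc) (q ∘ suc) j λ i i≢j → agree (suc i) (i≢j ∘ suc-injective))

count-exchange : ∀ {n} (p q : Fin n → Bool) {i j} → i ≢ j →
                 (∀ k → k ≢ i → k ≢ j → p k ≡ q k) → p i ≡ q j → p j ≡ q i →
                 count p ≡ count q
count-exchange p q {i} {j} i≢j agree pi≡qj pj≡qi = +-cancelʳ-≡ _ _ _ $ begin
  count p + indicator (q i)  ≡⟨ cong (λ b → count p + indicator b) (sym (m-at-i)) ⟩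
  count p + indicator (m i)  ≡⟨ count-update p m i p≗m ⟩
  count m + indicator (p i)  ≡⟨ cong (λ b → count m + indicator b) pi≡qj ⟩
  count m + indicator (q j)  ≡⟨ count-update m q j m≗q ⟩
  count q + indicator (m j)  ≡⟨ cong (λ b → count q + indicator b) (trans m-at-j pj≡qi) ⟩
  count q + indicator (q i)  ∎
  where
  open ≡-Reasoning
  m : Fin _ → Bool
  m k = if does (k ≟ᶠ i) then q i else p k
  m-at-i : m i ≡ q i
  m-at-i rewrite dec-true (i ≟ᶠ i) refl = refl
  m-at-j : m j ≡ p j
  m-at-j rewrite dec-false (j ≟ᶠ i) (i≢j ∘ sym) = refl
  p≗m : ∀ k → k ≢ i → p k ≡ m k
  p≗m k k≢i rewrite dec-false (k ≟ᶠ i) k≢i = refl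
  m≗q : ∀ k → k ≢ j → m k ≡ q k
  m≗q k k≢j with k ≟ᶠ i
  ... | yes refl = refl
  ... | no k≢i   = agree k k≢i k≢j

length-filterᵇ-tabulate : ∀ {A : Set} {n} (p : A → Bool) (f : Fin n → A) →
                          length (filterᵇ p (tabulate f)) ≡ count (p ∘ f)
length-filterᵇ-tabulate {n = zero}  p f = refl
length-filterᵇ-tabulate {n = suc n} p f with p (f zero)
... | true  = cong suc (length-filterᵇ-tabulate p (f ∘ suc))
... | false = length-filterᵇ-tabulate p (f ∘ suc)

distinct-witnesses : ∀ {n} (p : Fin n → Bool) {r} → r ≤ count p →
                     Σ (Fin r → Fin n) λ g → Injective _≡_ _≡_ g × (∀ i → T (p (g i)))
distinct-witnesses p {zero} _ = (λ ()) , (λ { {()} }) , (λ ())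
distinct-witnesses {suc n} p {suc r} r<count with p zero in p0
... | true with distinct-witnesses (p ∘ suc) (≤-pred r<count)
...   | g , g-injective , g-witnesses = g' , g'-injective , g'-witnesses
  where
  g' : Fin (suc r) → Fin (suc n)
  g' zero    = zero
  g' (suc i) = suc (g i)
  g'-injective : Injective _≡_ _≡_ g'
  g'-injective {zero}  {zero}  _  = refl
  g'-injective {suc i} {suc j} eq = cong suc (g-injective (suc-injective eq))
  g'-witnesses : ∀ i → T (p (g' i))
  g'-witnesses zero    = subst T (sym p0) _
  g'-witnesses (suc i) = g-witnesses i
distinct-witnesses {suc n} p {suc r} r<count | false with distinct-witnesses (p ∘ suc) r<count
... | g , g-injective , g-witnesses = suc ∘ g , g-injective ∘ suc-injective , g-witnesses

double-counting : ∀ {m n} (M : Fin m → Fin n → Bool) {a : Fin m → ℕ} {b : Fin n → ℕ} →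
                  (∀ i → a i ≤ count (M i)) → (∀ j → count (λ i → M i j) ≤ b j) →
                  sum a ≤ sum b
double-counting M {a} {b} rows cols = begin
  sum a                                        ≤⟨ ∑-mono-≤ rows ⟩
  sum (λ i → sum λ j → indicator (M i j))      ≡⟨ ∑-comm (λ i j → indicator (M i j)) ⟩
  sum (λ j → sum λ i → indicator (M i j))      ≤⟨ ∑-mono-≤ cols ⟩
  sum b                                        ∎
  where open ≤-Reasoning

concatMap-concatMap : ∀ {A B C : Set} (g : B → List C) (f : A → List B) xs →
                      concatMap g (concatMap f xs) ≡ concatMap (concatMap g ∘ f) xs
concatMap-concatMap g f []       = refl
concatMap-concatMap g f (x ∷ xs) =
  trans (concatMap-++ g (f x) (concatMap f xs)) (cong (concatMap g (f x) ++_) (concatMap-concatMap g f xs))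

three-distinct : ∀ {A : Set} {a b c : A} → a ≢ b → a ≢ c → b ≢ c → Unique (a ∷ b ∷ c ∷ [])
three-distinct a≢b a≢c b≢c = (a≢b ∷ a≢c ∷ []) ∷ (b≢c ∷ []) ∷ [] ∷ []

concatMap-partition-↭ : ∀ {m n} (block : Fin m → List (Fin n)) (owner : Fin n → Fin m) →
                        (∀ i → Unique (block i)) → (∀ i {x} → x ∈ block i → owner x ≡ i) →
                        (∀ x → x ∈ block (owner x)) → concatMap block (allFin m) ↭ allFin n
concatMap-partition-↭ {m} {n} block owner unique owned covers =
  ∼bag⇒↭ (unique∧set⇒bag blocks-unique (allFin⁺ n) λ {x} →
    mk⇔ (λ _ → ∈-allFin x) (λ _ → ∈-concatMap⁺ block (lose (∈-allFin (owner x)) (covers x))))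
  where
  disjoint : ∀ {i j} → i ≢ j → Disjoint (block i) (block j)
  disjoint i≢j (x∈i , x∈j) = i≢j (trans (sym (owned _ x∈i)) (owned _ x∈j))
  blocks-unique : Unique (concatMap block (allFin m))
  blocks-unique = concat⁺ (All.map⁺ (All.universal unique (allFin m)))
                          (AllPairs.map⁺ (AllPairs.map disjoint (allFin⁺ m)))

degree-counting-absurd : ∀ k s a d → suc k * d ≤ s * a → 2 * a ≤ d + 2 → suc k ≤ a → s < k + k → ⊥
degree-counting-absurd k s a d edges ends a-large s-small =
  <⇒≱ (*-monoˡ-< (suc k) {2} {3} ≤-refl) (≤-trans (*-monoʳ-≤ 3 a-large) three-a≤)
  where
  open ≤-Reasoning
  three-a≤ : 3 * a ≤ 2 * suc k
  three-a≤ = +-cancelˡ-≤ ((k + k) * a) _ _ $ begin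
    (k + k) * a + 3 * a          ≡⟨ regroup k a ⟩
    suc k * (2 * a) + a          ≤⟨ +-monoˡ-≤ a (*-monoʳ-≤ (suc k) ends) ⟩
    suc k * (d + 2) + a          ≡⟨ distribute k d a ⟩
    suc k * d + a + 2 * suc k    ≤⟨ +-monoˡ-≤ (2 * suc k) (+-monoˡ-≤ a edges) ⟩
    s * a + a + 2 * suc k        ≡⟨ cong (_+ 2 * suc k) (+-comm (s * a) a) ⟩
    suc s * a + 2 * suc k        ≤⟨ +-monoˡ-≤ (2 * suc k) (*-monoˡ-≤ a s-small) ⟩
    (k + k) * a + 2 * suc k      ∎
    where
    regroup : ∀ k a → (k + k) * a + 3 * a ≡ suc k * (2 * a) + a
    regroup = solve-∀
    distribute : ∀ k d a → suc k * (d + 2) + a ≡ suc k * d + a + 2 * suc k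
    distribute = solve-∀

pred<⌈/2⌉+⌈/2⌉ : ∀ {r} → 0 < r → pred r < ⌈ r /2⌉ + ⌈ r /2⌉
pred<⌈/2⌉+⌈/2⌉ {suc r} _ =
  ≤-trans (≤-reflexive (sym (⌊n/2⌋+⌈n/2⌉≡n (suc r))))
          (+-monoˡ-≤ ⌈ suc r /2⌉ (⌊n/2⌋≤⌈n/2⌉ (suc r)))

degree≡count : ∀ {n} (G : Graph n) v → degree G v ≡ count (adj G v)
degree≡count G v = length-filterᵇ-tabulate (adj G v) (λ i → i)

module _ {n} (G : Graph n) where

  Adj-sym : ∀ {u v} → Adj G u v → Adj G v u
  Adj-sym {u} {v} = subst T (adj-symmetric G u v)

  Adj⇒≢ : ∀ {u v} → Adj G u v → u ≢ v
  Adj⇒≢ {u} uv refl = subst T (irrefl G u) uv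

UEdge-flip : ∀ {n} {x y a b : Fin n} → UEdge x y a b → UEdge y x a b
UEdge-flip (inj₁ (x≡a , y≡b)) = inj₂ (y≡b , x≡a)
UEdge-flip (inj₂ (x≡b , y≡a)) = inj₁ (y≡a , x≡b)

UEdge-swap : ∀ {n} {x y a b : Fin n} → UEdge x y a b → UEdge a b x y
UEdge-swap (inj₁ (x≡a , y≡b)) = inj₁ (sym x≡a , sym y≡b)
UEdge-swap (inj₂ (x≡b , y≡a)) = inj₂ (sym y≡a , sym x≡b)

UEdge-other : ∀ {n} {e₁ e₂ u q u' q' : Fin n} →
              UEdge u q e₁ e₂ → UEdge u' q' e₁ e₂ → u ≢ u' → u' ≡ q
UEdge-other (inj₁ (refl , refl)) (inj₁ (refl , _)) u≢u' = ⊥-elim (u≢u' refl)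
UEdge-other (inj₁ (refl , refl)) (inj₂ (refl , _)) _    = refl
UEdge-other (inj₂ (refl , refl)) (inj₁ (refl , _)) _    = refl
UEdge-other (inj₂ (refl , refl)) (inj₂ (refl , _)) u≢u' = ⊥-elim (u≢u' refl)

module PartialFactors {n} (G : Graph n) (e₁ e₂ : Fin n) where

  open import Data.List.Membership.DecPropositional (_≟ᶠ_ {n}) using (_∈?_)

  -- middle a c: v is the middle of the P₃ a–v–c; end h: v is a free end of the P₃ with middle h.
  -- A P₃ a–v–c with {v, c} = {e₁, e₂} is locked: c is its lockedEnd and only a may be exchanged.
  data Role : Set where
    uncovered         : Role
    paired            : Fin n → Role
    middle            : Fin n → Fin n → Role
    lockedMiddle      : Fin n → Fin n → Role
    end lockedEnd     : Fin n → Role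

  data FreeEndOf (ρ : Fin n → Role) (a h c : Fin n) : Set where
    first  : ρ h ≡ middle a c       → FreeEndOf ρ a h c
    second : ρ h ≡ middle c a       → FreeEndOf ρ a h c
    locked : ρ h ≡ lockedMiddle a c → FreeEndOf ρ a h c

  Consistent : (Fin n → Role) → Fin n → Role → Set
  Consistent ρ v uncovered          = ⊤
  Consistent ρ v (paired b)         = Adj G v b × ρ b ≡ paired v
  Consistent ρ v (middle a c)       = Adj G a v × Adj G v c × a ≢ c × ρ a ≡ end v × ρ c ≡ end v
  Consistent ρ v (lockedMiddle a c) =
    Adj G a v × Adj G v c × ρ a ≡ end v × ρ c ≡ lockedEnd v × UEdge v c e₁ e₂
  Consistent ρ v (end h)            = ∃ (FreeEndOf ρ v h)
  Consistent ρ v (lockedEnd h)      = ∃ λ a → ρ h ≡ lockedMiddle a v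

  CarriesEdge : Fin n → Role → Set
  CarriesEdge v (paired b)         = UEdge v b e₁ e₂
  CarriesEdge v (lockedMiddle a c) = UEdge v c e₁ e₂
  CarriesEdge v _                  = ⊥

  KeepsEdge : (Fin n → Role) → Set
  KeepsEdge ρ = ∃ λ v → CarriesEdge v (ρ v)

  record PartialFactor : Set where
    field
      role       : Fin n → Role
      consistent : ∀ v → Consistent role v (role v)
      keepsEdge  : KeepsEdge role
  open PartialFactor public

  roleAt : (P : Role → Set) {r R : Role} → r ≡ R → P R → P r
  roleAt P e = subst P (sym e)

  consistentAt : (S : PartialFactor) {v : Fin n} {R : Role} → role S v ≡ R → Consistent (role S) v R
  consistentAt S {v} e = subst (Consistent (role S) v) e (consistent S v)

  lockedMiddle-edge : (S : PartialFactor) {v a c : Fin n} → role S v ≡ lockedMiddle a c → UEdge v c e₁ e₂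
  lockedMiddle-edge S e = let (_ , _ , _ , _ , edge) = consistentAt S e in edge

  lockedMiddle-other : (S : PartialFactor) {v a c : Fin n} → role S v ≡ lockedMiddle a c →
                       role S c ≡ lockedEnd v
  lockedMiddle-other S e = let (_ , _ , _ , ec , _) = consistentAt S e in ec

  Mentions : Role → Fin n → Set
  Mentions uncovered          w = ⊥
  Mentions (paired b)         w = w ≡ b
  Mentions (middle a c)       w = w ≡ a ⊎ w ≡ c
  Mentions (lockedMiddle a c) w = w ≡ a ⊎ w ≡ c
  Mentions (end h)            w = w ≡ h
  Mentions (lockedEnd h)      w = w ≡ h

  mentions-sym : (S : PartialFactor) {v w : Fin n} → Mentions (role S v) w → Mentions (role S w) v
  mentions-sym S {v} = go (role S v) refl
    where
    go : ∀ R {w} → role S v ≡ R → Mentions R w → Mentions (role S w) v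
    go (paired b)         e refl = subst (λ R → Mentions R v) (sym (proj₂ (consistentAt S e))) refl
    go (middle a c)       e (inj₁ refl) with consistentAt S e
    ... | _ , _ , _ , ea , _ rewrite ea = refl
    go (middle a c)       e (inj₂ refl) with consistentAt S e
    ... | _ , _ , _ , _ , ec rewrite ec = refl
    go (lockedMiddle a c) e (inj₁ refl) with consistentAt S e
    ... | _ , _ , ea , _ rewrite ea = refl
    go (lockedMiddle a c) e (inj₂ refl) with consistentAt S e
    ... | _ , _ , _ , ec , _ rewrite ec = refl
    go (end h)            e refl with consistentAt S e
    ... | _ , first  eh rewrite eh = inj₁ refl
    ... | _ , second eh rewrite eh = inj₂ refl
    ... | _ , locked eh rewrite eh = inj₁ refl
    go (lockedEnd h)      e refl with consistentAt S e
    ... | _ , eh rewrite eh = inj₂ refl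

  freeEnd-transfer : ∀ {ρ ρ' : Fin n → Role} {a h c} → ρ' h ≡ ρ h →
                     FreeEndOf ρ a h c → FreeEndOf ρ' a h c
  freeEnd-transfer eq (first  e) = first  (trans eq e)
  freeEnd-transfer eq (second e) = second (trans eq e)
  freeEnd-transfer eq (locked e) = locked (trans eq e)

  consistent-transfer : ∀ {ρ ρ' : Fin n → Role} v R → (∀ w → Mentions R w → ρ' w ≡ ρ w) →
                        Consistent ρ v R → Consistent ρ' v R
  consistent-transfer v uncovered          agree _ = _
  consistent-transfer v (paired b)         agree (vb , eb) = vb , trans (agree b refl) eb
  consistent-transfer v (middle a c)       agree (av , vc , a≢c , ea , ec) =
    av , vc , a≢c , trans (agree a (inj₁ refl)) ea , trans (agree c (inj₂ refl)) ec
  consistent-transfer v (lockedMiddle a c) agree (av , vc , ea , ec , edge) =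
    av , vc , trans (agree a (inj₁ refl)) ea , trans (agree c (inj₂ refl)) ec , edge
  consistent-transfer v (end h)            agree (c , fe) = c , freeEnd-transfer (agree h refl) fe
  consistent-transfer v (lockedEnd h)      agree (a , eh) = a , trans (agree h refl) eh

  override : List (Fin n × Role) → (Fin n → Role) → Fin n → Role
  override []             ρ w = ρ w
  override ((k , R) ∷ as) ρ w = if does (w ≟ᶠ k) then R else override as ρ w

  keys : List (Fin n × Role) → List (Fin n)
  keys = map proj₁

  override-outside : ∀ as ρ {w} → w ∉ keys as → override as ρ w ≡ ρ w
  override-outside []             ρ w∉ = refl
  override-outside ((k , R) ∷ as) ρ {w} w∉
    rewrite dec-false (w ≟ᶠ k) (w∉ ∘ here) = override-outside as ρ (w∉ ∘ there)

  Closed : (Fin n → Role) → List (Fin n) → Set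
  Closed ρ K = All (λ w → ∀ {u} → Mentions (ρ w) u → u ∈ K) K

  -- Outside the keys consistency is inherited: the keys are closed under mentions and mentions
  -- are symmetric, so no other role refers to a changed vertex.
  rewire : (S : PartialFactor) (as : List (Fin n × Role)) → Closed (role S) (keys as) →
           All (λ w → Consistent (override as (role S)) w (override as (role S) w)) (keys as) →
           KeepsEdge (override as (role S)) → PartialFactor
  rewire S as closed local keeps = record
    { role = ρ' ; consistent = consistent' ; keepsEdge = keeps }
    where
    ρ' : Fin n → Role
    ρ' = override as (role S)
    consistent' : ∀ v → Consistent ρ' v (ρ' v)
    consistent' v with v ∈? keys as
    ... | yes v∈ = All.lookup local v∈
    ... | no  v∉ = subst (Consistent ρ' v) (sym (override-outside as (role S) v∉)) $
      consistent-transfer v (role S v)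
        (λ w m → override-outside as (role S) λ w∈ → v∉ (All.lookup closed w∈ (mentions-sym S m)))
        (consistent S v)

  keepsEdge-override : (S : PartialFactor) (as : List (Fin n × Role)) →
                       All (λ w → ¬ CarriesEdge w (role S w)) (keys as) →
                       KeepsEdge (override as (role S))
  keepsEdge-override S as untouched with keepsEdge S
  ... | v , carries = v , subst (CarriesEdge v) (sym (override-outside as (role S) v∉)) carries
    where
    v∉ : v ∉ keys as
    v∉ v∈ = All.lookup untouched v∈ carries

  isUncovered : Role → Bool
  isUncovered uncovered = true
  isUncovered _         = false

  uncovered-at : ∀ R → T (isUncovered R) → R ≡ uncovered
  uncovered-at uncovered _ = refl

  uncoveredCount : PartialFactor → ℕ
  uncoveredCount S = count (isUncovered ∘ role S)

  override-covers : (S : PartialFactor) (as : List (Fin n × Role)) {x : Fin n} → x ∈ keys as →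
                    role S x ≡ uncovered → All (λ w → ¬ T (isUncovered (override as (role S) w))) (keys as) →
                    count (isUncovered ∘ override as (role S)) < uncoveredCount S
  override-covers S as {x} x∈ ux covered =
    count-mono-< shrinks x (roleAt (T ∘ isUncovered) ux _) (All.lookup covered x∈)
    where
    shrinks : ∀ w → T (isUncovered (override as (role S) w)) → T (isUncovered (role S w))
    shrinks w t with w ∈? keys as
    ... | yes w∈ = ⊥-elim (All.lookup covered w∈ t)
    ... | no  w∉ = subst (T ∘ isUncovered) (override-outside as (role S) w∉) t

  roles-differ : ∀ {ρ : Fin n → Role} {u w R R'} → ρ u ≡ R → ρ w ≡ R' → R ≢ R' → u ≢ w
  roles-differ eu ew R≢R' refl = R≢R' (trans (sym eu) ew)

  -- Roles of the vertices an uncovered neighbour can be attached to.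
  isAbsorbing : Role → Bool
  isAbsorbing uncovered  = true
  isAbsorbing (paired _) = true
  isAbsorbing (end _)    = true
  isAbsorbing _          = false

  module _ {ρ : Fin n → Role} {a h c : Fin n} where

    middleRole : FreeEndOf ρ a h c → Role
    middleRole (first  _) = middle a c
    middleRole (second _) = middle c a
    middleRole (locked _) = lockedMiddle a c

    middle-role : (fe : FreeEndOf ρ a h c) → ρ h ≡ middleRole fe
    middle-role (first  e) = e
    middle-role (second e) = e
    middle-role (locked e) = e

    otherEndRole : FreeEndOf ρ a h c → Role
    otherEndRole (locked _) = lockedEnd h
    otherEndRole _          = end h

    middle-inner : (fe : FreeEndOf ρ a h c) → ¬ T (isAbsorbing (middleRole fe))
    middle-inner (first  _) ()
    middle-inner (second _) ()
    middle-inner (locked _) ()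

  module _ (S : PartialFactor) {a h c : Fin n} where

    end-role : FreeEndOf (role S) a h c → role S a ≡ end h
    end-role (first  e) = let (_ , _ , _ , ea , _) = consistentAt S e in ea
    end-role (second e) = let (_ , _ , _ , _ , ea) = consistentAt S e in ea
    end-role (locked e) = let (_ , _ , ea , _) = consistentAt S e in ea

    other-role : (fe : FreeEndOf (role S) a h c) → role S c ≡ otherEndRole fe
    other-role (first  e) = let (_ , _ , _ , _ , ec) = consistentAt S e in ec
    other-role (second e) = let (_ , _ , _ , ec , _) = consistentAt S e in ec
    other-role (locked e) = lockedMiddle-other S e

    end-adj : FreeEndOf (role S) a h c → Adj G a h
    end-adj (first  e) = proj₁ (consistentAt S e)
    end-adj (second e) = Adj-sym G (proj₁ (proj₂ (consistentAt S e)))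
    end-adj (locked e) = proj₁ (consistentAt S e)

    other-adj : FreeEndOf (role S) a h c → Adj G h c
    other-adj (first  e) = proj₁ (proj₂ (consistentAt S e))
    other-adj (second e) = Adj-sym G (proj₁ (consistentAt S e))
    other-adj (locked e) = proj₁ (proj₂ (consistentAt S e))

    end≢other : FreeEndOf (role S) a h c → a ≢ c
    end≢other (first  e) = let (_ , _ , a≢c , _) = consistentAt S e in a≢c
    end≢other (second e) = let (_ , _ , c≢a , _) = consistentAt S e in c≢a ∘ sym
    end≢other fe@(locked _) = roles-differ (end-role fe) (other-role fe) λ ()

    absorbing≢middle : ∀ {x} → T (isAbsorbing (role S x)) → FreeEndOf (role S) a h c → x ≢ h
    absorbing≢middle absorbing fe refl = middle-inner fe (subst (T ∘ isAbsorbing) (middle-role fe) absorbing)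

    uncovered≢other : ∀ {x} → role S x ≡ uncovered → (fe : FreeEndOf (role S) a h c) → x ≢ c
    uncovered≢other ux fe = roles-differ ux (other-role fe) (helper fe)
      where
      helper : (fe : FreeEndOf (role S) a h c) → uncovered ≢ otherEndRole fe
      helper (first  _) ()
      helper (second _) ()
      helper (locked _) ()

  mentionsAt : ∀ {r R u} → r ≡ R → Mentions r u → Mentions R u
  mentionsAt {u = u} = subst (λ R → Mentions R u)

  newMiddleRole : ∀ {ρ a h c} → Fin n → FreeEndOf ρ a h c → Role
  newMiddleRole {c = c} x (locked _) = lockedMiddle x c
  newMiddleRole {c = c} x _          = middle x c

  path-closed : (S : PartialFactor) {x a h c : Fin n} → role S x ≡ uncovered → (fe : FreeEndOf (role S) a h c) →
                Closed (role S) (x ∷ a ∷ h ∷ c ∷ [])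
  path-closed S ux fe =
      (λ m → ⊥-elim (mentionsAt ux m))
    ∷ (λ m → there (there (here (mentionsAt (end-role S fe) m))))
    ∷ (λ m → middle-mentions fe (mentionsAt (middle-role fe) m))
    ∷ (λ m → there (there (here (other-mentions fe (mentionsAt (other-role S fe) m)))))
    ∷ []
    where
    middle-mentions : ∀ {x a h c u} (fe : FreeEndOf (role S) a h c) → Mentions (middleRole fe) u →
                      u ∈ x ∷ a ∷ h ∷ c ∷ []
    middle-mentions (first  _) (inj₁ u≡a) = there (here u≡a)
    middle-mentions (first  _) (inj₂ u≡c) = there (there (there (here u≡c)))
    middle-mentions (second _) (inj₁ u≡c) = there (there (there (here u≡c)))
    middle-mentions (second _) (inj₂ u≡a) = there (here u≡a)
    middle-mentions (locked _) (inj₁ u≡a) = there (here u≡a)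
    middle-mentions (locked _) (inj₂ u≡c) = there (there (there (here u≡c)))
    other-mentions : ∀ {a h c u} (fe : FreeEndOf (role S) a h c) → Mentions (otherEndRole fe) u → u ≡ h
    other-mentions (first  _) m = m
    other-mentions (second _) m = m
    other-mentions (locked _) m = m

  initial : Adj G e₁ e₂ → PartialFactor
  initial e₁e₂ = record
    { role       = ρ₀
    ; consistent = consistent₀
    ; keepsEdge  = e₁ , roleAt (CarriesEdge e₁) ρ₀e₁ (inj₁ (refl , refl))
    }
    where
    pair : List (Fin n × Role)
    pair = (e₁ , paired e₂) ∷ (e₂ , paired e₁) ∷ []
    ρ₀ : Fin n → Role
    ρ₀ = override pair (λ _ → uncovered)
    ρ₀e₁ : ρ₀ e₁ ≡ paired e₂
    ρ₀e₁ rewrite dec-true (e₁ ≟ᶠ e₁) refl = refl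
    ρ₀e₂ : ρ₀ e₂ ≡ paired e₁
    ρ₀e₂ rewrite dec-false (e₂ ≟ᶠ e₁) (Adj⇒≢ G e₁e₂ ∘ sym) | dec-true (e₂ ≟ᶠ e₂) refl = refl
    consistent₀ : ∀ v → Consistent ρ₀ v (ρ₀ v)
    consistent₀ v = by-cases (v ≟ᶠ e₁) (v ≟ᶠ e₂)
      where
      by-cases : Dec (v ≡ e₁) → Dec (v ≡ e₂) → Consistent ρ₀ v (ρ₀ v)
      by-cases (yes refl) _          = roleAt (Consistent ρ₀ e₁) ρ₀e₁ (e₁e₂ , ρ₀e₂)
      by-cases (no _)     (yes refl) = roleAt (Consistent ρ₀ e₂) ρ₀e₂ (Adj-sym G e₁e₂ , ρ₀e₁)
      by-cases (no v≢e₁)  (no v≢e₂)  = roleAt (Consistent ρ₀ v)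
        (override-outside pair (λ _ → uncovered)
          λ { (here v≡e₁) → v≢e₁ v≡e₁ ; (there (here v≡e₂)) → v≢e₂ v≡e₂ })
        _

  -- Exchanges and attachments

  module Exchange (S : PartialFactor) {x₀ a h c : Fin n} (ux₀ : role S x₀ ≡ uncovered) (x₀h : Adj G x₀ h)
                  (fe : FreeEndOf (role S) a h c) where

    changes : List (Fin n × Role)
    -- c keeps its role; it is listed because its role and that of h mention each other.
    changes = (x₀ , end h) ∷ (a , uncovered) ∷ (h , newMiddleRole x₀ fe) ∷ (c , role S c) ∷ []

    ρ' : Fin n → Role
    ρ' = override changes (role S)

    x₀≢a : x₀ ≢ a
    x₀≢a = roles-differ ux₀ (end-role S fe) λ ()
    x₀≢h : x₀ ≢ h
    x₀≢h = absorbing≢middle S (roleAt (T ∘ isAbsorbing) ux₀ _) fe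
    x₀≢c : x₀ ≢ c
    x₀≢c = uncovered≢other S ux₀ fe
    a≢h : a ≢ h
    a≢h = Adj⇒≢ G (end-adj S fe)
    a≢c : a ≢ c
    a≢c = end≢other S fe
    h≢c : h ≢ c
    h≢c = Adj⇒≢ G (other-adj S fe)

    ρ'x₀ : ρ' x₀ ≡ end h
    ρ'x₀ rewrite dec-true (x₀ ≟ᶠ x₀) refl = refl
    ρ'a : ρ' a ≡ uncovered
    ρ'a rewrite dec-false (a ≟ᶠ x₀) (x₀≢a ∘ sym) | dec-true (a ≟ᶠ a) refl = refl
    ρ'h : ρ' h ≡ newMiddleRole x₀ fe
    ρ'h rewrite dec-false (h ≟ᶠ x₀) (x₀≢h ∘ sym) | dec-false (h ≟ᶠ a) (a≢h ∘ sym)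
              | dec-true (h ≟ᶠ h) refl = refl
    ρ'c : ρ' c ≡ role S c
    ρ'c rewrite dec-false (c ≟ᶠ x₀) (x₀≢c ∘ sym) | dec-false (c ≟ᶠ a) (a≢c ∘ sym)
              | dec-false (c ≟ᶠ h) (h≢c ∘ sym) | dec-true (c ≟ᶠ c) refl = refl
    ρ'-elsewhere : ∀ w → w ≢ x₀ → w ≢ a → w ≢ h → ρ' w ≡ role S w
    ρ'-elsewhere w w≢x₀ w≢a w≢h = by-cases (w ≟ᶠ c)
      where
      by-cases : Dec (w ≡ c) → ρ' w ≡ role S w
      by-cases (yes refl) = ρ'c
      by-cases (no  w≢c)  = override-outside changes (role S) λ
        { (here w≡x₀) → w≢x₀ w≡x₀ ; (there (here w≡a)) → w≢a w≡a
        ; (there (there (here w≡h))) → w≢h w≡h ; (there (there (there (here w≡c)))) → w≢c w≡c }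

    local : All (λ w → Consistent ρ' w (ρ' w)) (keys changes)
    local = roleAt (Consistent ρ' x₀) ρ'x₀ (c , new-end fe ρ'h)
          ∷ roleAt (Consistent ρ' a) ρ'a _
          ∷ roleAt (Consistent ρ' h) ρ'h (new-middle fe)
          ∷ roleAt (Consistent ρ' c) ρ'c (roleAt (Consistent ρ' c) (other-role S fe) (new-other fe ρ'h))
          ∷ []
      where
      new-end : (fe : FreeEndOf (role S) a h c) → ρ' h ≡ newMiddleRole x₀ fe → FreeEndOf ρ' x₀ h c
      new-end (first  _) = first
      new-end (second _) = first
      new-end (locked _) = locked
      ρ'c-other : (fe : FreeEndOf (role S) a h c) → ρ' c ≡ otherEndRole fe
      ρ'c-other fe = trans ρ'c (other-role S fe)
      new-middle : (fe : FreeEndOf (role S) a h c) → Consistent ρ' h (newMiddleRole x₀ fe)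
      new-middle fe@(first  _) = x₀h , other-adj S fe , x₀≢c , ρ'x₀ , ρ'c-other fe
      new-middle fe@(second _) = x₀h , other-adj S fe , x₀≢c , ρ'x₀ , ρ'c-other fe
      new-middle fe@(locked e) = x₀h , other-adj S fe , ρ'x₀ , ρ'c-other fe , lockedMiddle-edge S e
      new-other : (fe : FreeEndOf (role S) a h c) → ρ' h ≡ newMiddleRole x₀ fe →
                  Consistent ρ' c (otherEndRole fe)
      new-other (first  _) eh = x₀ , second eh
      new-other (second _) eh = x₀ , second eh
      new-other (locked _) eh = x₀ , eh

    keeps : KeepsEdge ρ'
    keeps = by-cases fe ρ'h
      where
      unlocked : ∀ {p q} → role S h ≡ middle p q → role S c ≡ end h → KeepsEdge ρ'
      unlocked eh ec = keepsEdge-override S changes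
        ( roleAt (¬_ ∘ CarriesEdge x₀) ux₀ id ∷ roleAt (¬_ ∘ CarriesEdge a) (end-role S fe) id
        ∷ roleAt (¬_ ∘ CarriesEdge h) eh id ∷ roleAt (¬_ ∘ CarriesEdge c) ec id ∷ [])
      by-cases : (fe : FreeEndOf (role S) a h c) → ρ' h ≡ newMiddleRole x₀ fe → KeepsEdge ρ'
      by-cases fe@(first  e) _   = unlocked e (other-role S fe)
      by-cases fe@(second e) _   = unlocked e (other-role S fe)
      by-cases (locked e) ρ'h = h , roleAt (CarriesEdge h) ρ'h (lockedMiddle-edge S e)

    result : PartialFactor
    result = rewire S changes (path-closed S ux₀ fe) local keeps

    classify-elsewhere : (f : Role → Bool) → (∀ p q → f (middle p q) ≡ false) →
                         (∀ p q → f (lockedMiddle p q) ≡ false) →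
                         ∀ w → w ≢ x₀ → w ≢ a → f (ρ' w) ≡ f (role S w)
    classify-elsewhere f f-middle f-locked w w≢x₀ w≢a = by-cases (w ≟ᶠ h)
      where
      both-false : (fe : FreeEndOf (role S) a h c) → f (newMiddleRole x₀ fe) ≡ f (middleRole fe)
      both-false (first  _) = trans (f-middle _ _) (sym (f-middle _ _))
      both-false (second _) = trans (f-middle _ _) (sym (f-middle _ _))
      both-false (locked _) = trans (f-locked _ _) (sym (f-locked _ _))
      by-cases : Dec (w ≡ h) → f (ρ' w) ≡ f (role S w)
      by-cases (no  w≢h) = cong f (ρ'-elsewhere w w≢x₀ w≢a w≢h)
      by-cases (yes refl) = trans (cong f ρ'h) (trans (both-false fe) (sym (cong f (middle-role fe))))

    uncoveredCount-preserved : uncoveredCount result ≡ uncoveredCount S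
    uncoveredCount-preserved = sym $ count-exchange (isUncovered ∘ role S) (isUncovered ∘ ρ') x₀≢a
      (λ w w≢x₀ w≢a → sym (classify-elsewhere isUncovered (λ _ _ → refl) (λ _ _ → refl) w w≢x₀ w≢a))
      (trans (cong isUncovered ux₀) (sym (cong isUncovered ρ'a)))
      (trans (cong isUncovered (end-role S fe)) (sym (cong isUncovered ρ'x₀)))

    absorbing-preserved : ∀ w → isAbsorbing (role result w) ≡ isAbsorbing (role S w)
    absorbing-preserved w = by-cases (w ≟ᶠ x₀) (w ≟ᶠ a)
      where
      by-cases : Dec (w ≡ x₀) → Dec (w ≡ a) → isAbsorbing (ρ' w) ≡ isAbsorbing (role S w)
      by-cases (yes refl) _          = trans (cong isAbsorbing ρ'x₀) (sym (cong isAbsorbing ux₀))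
      by-cases (no _)     (yes refl) = trans (cong isAbsorbing ρ'a) (sym (cong isAbsorbing (end-role S fe)))
      by-cases (no w≢x₀)  (no w≢a)   =
        classify-elsewhere isAbsorbing (λ _ _ → refl) (λ _ _ → refl) w w≢x₀ w≢a

  Improvement : PartialFactor → Set
  Improvement S = ∃ λ S' → uncoveredCount S' < uncoveredCount S

  module AttachToUncovered (S : PartialFactor) {x z : Fin n} (ux : role S x ≡ uncovered)
                           (uz : role S z ≡ uncovered) (xz : Adj G x z) where

    changes : List (Fin n × Role)
    changes = (x , paired z) ∷ (z , paired x) ∷ []

    ρ' : Fin n → Role
    ρ' = override changes (role S)

    ρ'x : ρ' x ≡ paired z
    ρ'x rewrite dec-true (x ≟ᶠ x) refl = refl
    ρ'z : ρ' z ≡ paired x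
    ρ'z rewrite dec-false (z ≟ᶠ x) (Adj⇒≢ G xz ∘ sym) | dec-true (z ≟ᶠ z) refl = refl

    improvement : Improvement S
    improvement =
      rewire S changes
        ((λ m → ⊥-elim (mentionsAt ux m)) ∷ (λ m → ⊥-elim (mentionsAt uz m)) ∷ [])
        (roleAt (Consistent ρ' x) ρ'x (xz , ρ'z) ∷ roleAt (Consistent ρ' z) ρ'z (Adj-sym G xz , ρ'x) ∷ [])
        (keepsEdge-override S changes
          (roleAt (¬_ ∘ CarriesEdge x) ux id ∷ roleAt (¬_ ∘ CarriesEdge z) uz id ∷ [])) ,
      override-covers S changes (here refl) ux
        (roleAt (¬_ ∘ T ∘ isUncovered) ρ'x id ∷ roleAt (¬_ ∘ T ∘ isUncovered) ρ'z id ∷ [])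

  module AttachToPair (S : PartialFactor) {x z b : Fin n} (ux : role S x ≡ uncovered)
                      (ez : role S z ≡ paired b) (xz : Adj G x z) where

    zb : Adj G z b
    zb = proj₁ (consistentAt S ez)
    eb : role S b ≡ paired z
    eb = proj₂ (consistentAt S ez)
    x≢z : x ≢ z
    x≢z = Adj⇒≢ G xz
    x≢b : x ≢ b
    x≢b = roles-differ ux eb λ ()
    z≢b : z ≢ b
    z≢b = Adj⇒≢ G zb

    module Into (M E : Role) where

      changes : List (Fin n × Role)
      changes = (x , end z) ∷ (z , M) ∷ (b , E) ∷ []

      ρ' : Fin n → Role
      ρ' = override changes (role S)

      ρ'x : ρ' x ≡ end z
      ρ'x rewrite dec-true (x ≟ᶠ x) refl = refl
      ρ'z : ρ' z ≡ M
      ρ'z rewrite dec-false (z ≟ᶠ x) (x≢z ∘ sym) | dec-true (z ≟ᶠ z) refl = refl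
      ρ'b : ρ' b ≡ E
      ρ'b rewrite dec-false (b ≟ᶠ x) (x≢b ∘ sym) | dec-false (b ≟ᶠ z) (z≢b ∘ sym)
                | dec-true (b ≟ᶠ b) refl = refl

      closed : Closed (role S) (keys changes)
      closed = (λ m → ⊥-elim (mentionsAt ux m))
             ∷ (λ m → there (there (here (mentionsAt ez m))))
             ∷ (λ m → there (here (mentionsAt eb m)))
             ∷ []

      build : Consistent ρ' x (end z) → Consistent ρ' z M → Consistent ρ' b E → KeepsEdge ρ' →
              ¬ T (isUncovered M) → ¬ T (isUncovered E) → Improvement S
      build x-consistent M-consistent E-consistent keeps M-covered E-covered =
        rewire S changes closed
          ( roleAt (Consistent ρ' x) ρ'x x-consistent ∷ roleAt (Consistent ρ' z) ρ'z M-consistent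
          ∷ roleAt (Consistent ρ' b) ρ'b E-consistent ∷ [])
          keeps ,
        override-covers S changes (here refl) ux
          ( roleAt (¬_ ∘ T ∘ isUncovered) ρ'x id ∷ roleAt (¬_ ∘ T ∘ isUncovered) ρ'z M-covered
          ∷ roleAt (¬_ ∘ T ∘ isUncovered) ρ'b E-covered ∷ [])

    unlockedCase : ¬ UEdge z b e₁ e₂ → Improvement S
    unlockedCase ¬edge = build (b , first ρ'z) (xz , zb , x≢b , ρ'x , ρ'b) (x , second ρ'z) keeps (λ ()) (λ ())
      where
      open Into (middle x b) (end z)
      keeps : KeepsEdge ρ'
      keeps = keepsEdge-override S changes
        ( roleAt (¬_ ∘ CarriesEdge x) ux id ∷ roleAt (¬_ ∘ CarriesEdge z) ez ¬edge
        ∷ roleAt (¬_ ∘ CarriesEdge b) eb (¬edge ∘ UEdge-flip) ∷ [])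

    lockedCase : UEdge z b e₁ e₂ → Improvement S
    lockedCase edge = build (b , locked ρ'z) (xz , zb , ρ'x , ρ'b , edge) (x , ρ'z)
                        (z , roleAt (CarriesEdge z) ρ'z edge) (λ ()) (λ ())
      where open Into (lockedMiddle x b) (lockedEnd z)

  module AttachToEnd (S : PartialFactor) {x z y c : Fin n} (ux : role S x ≡ uncovered) (xz : Adj G x z)
                     (fe : FreeEndOf (role S) z y c) where

    changes : List (Fin n × Role)
    changes = (x , paired z) ∷ (z , paired x) ∷ (y , paired c) ∷ (c , paired y) ∷ []

    ρ' : Fin n → Role
    ρ' = override changes (role S)

    x≢z : x ≢ z
    x≢z = Adj⇒≢ G xz
    x≢y : x ≢ y
    x≢y = absorbing≢middle S (roleAt (T ∘ isAbsorbing) ux _) fe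
    x≢c : x ≢ c
    x≢c = uncovered≢other S ux fe
    z≢y : z ≢ y
    z≢y = Adj⇒≢ G (end-adj S fe)
    z≢c : z ≢ c
    z≢c = end≢other S fe
    y≢c : y ≢ c
    y≢c = Adj⇒≢ G (other-adj S fe)

    ρ'x : ρ' x ≡ paired z
    ρ'x rewrite dec-true (x ≟ᶠ x) refl = refl
    ρ'z : ρ' z ≡ paired x
    ρ'z rewrite dec-false (z ≟ᶠ x) (x≢z ∘ sym) | dec-true (z ≟ᶠ z) refl = refl
    ρ'y : ρ' y ≡ paired c
    ρ'y rewrite dec-false (y ≟ᶠ x) (x≢y ∘ sym) | dec-false (y ≟ᶠ z) (z≢y ∘ sym)
              | dec-true (y ≟ᶠ y) refl = refl
    ρ'c : ρ' c ≡ paired y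
    ρ'c rewrite dec-false (c ≟ᶠ x) (x≢c ∘ sym) | dec-false (c ≟ᶠ z) (z≢c ∘ sym)
              | dec-false (c ≟ᶠ y) (y≢c ∘ sym) | dec-true (c ≟ᶠ c) refl = refl

    keeps : KeepsEdge ρ'
    keeps = by-cases fe
      where
      unlocked : ∀ {p q} → role S y ≡ middle p q → role S c ≡ end y → KeepsEdge ρ'
      unlocked ey ec = keepsEdge-override S changes
        ( roleAt (¬_ ∘ CarriesEdge x) ux id ∷ roleAt (¬_ ∘ CarriesEdge z) (end-role S fe) id
        ∷ roleAt (¬_ ∘ CarriesEdge y) ey id ∷ roleAt (¬_ ∘ CarriesEdge c) ec id ∷ [])
      by-cases : FreeEndOf (role S) z y c → KeepsEdge ρ'
      by-cases fe@(first  e) = unlocked e (other-role S fe)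
      by-cases fe@(second e) = unlocked e (other-role S fe)
      by-cases (locked e) = y , roleAt (CarriesEdge y) ρ'y (lockedMiddle-edge S e)

    improvement : Improvement S
    improvement =
      rewire S changes (path-closed S ux fe)
        ( roleAt (Consistent ρ' x) ρ'x (xz , ρ'z) ∷ roleAt (Consistent ρ' z) ρ'z (Adj-sym G xz , ρ'x)
        ∷ roleAt (Consistent ρ' y) ρ'y (other-adj S fe , ρ'c)
        ∷ roleAt (Consistent ρ' c) ρ'c (Adj-sym G (other-adj S fe) , ρ'y) ∷ [])
        keeps ,
      override-covers S changes (here refl) ux
        ( roleAt (¬_ ∘ T ∘ isUncovered) ρ'x id ∷ roleAt (¬_ ∘ T ∘ isUncovered) ρ'z id
        ∷ roleAt (¬_ ∘ T ∘ isUncovered) ρ'y id ∷ roleAt (¬_ ∘ T ∘ isUncovered) ρ'c id ∷ [])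

  UEdge? : ∀ v c → Dec (UEdge v c e₁ e₂)
  UEdge? v c = (v ≟ᶠ e₁ ×-dec c ≟ᶠ e₂) ⊎-dec (v ≟ᶠ e₂ ×-dec c ≟ᶠ e₁)

  attach : (S : PartialFactor) {x z : Fin n} → role S x ≡ uncovered → Adj G x z → T (isAbsorbing (role S z)) →
           Improvement S
  attach S {x} {z} ux xz absorbing with role S z in ez
  ... | uncovered = AttachToUncovered.improvement S ux ez xz
  ... | paired b with UEdge? z b
  ...   | yes edge = AttachToPair.lockedCase S ux ez xz edge
  ...   | no ¬edge = AttachToPair.unlockedCase S ux ez xz ¬edge
  attach S {x} {z} ux xz absorbing | end y with consistentAt S ez
  ...   | c , fe = AttachToEnd.improvement S ux xz fe

  -- Reachability by exchanges

  data Reachable : PartialFactor → Fin n → Set where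
    now   : ∀ {S x} → role S x ≡ uncovered → Reachable S x
    after : ∀ {S x x₀ a h c} (ux₀ : role S x₀ ≡ uncovered) (x₀h : Adj G x₀ h)
            (fe : FreeEndOf (role S) a h c) → Reachable (Exchange.result S ux₀ x₀h fe) x → Reachable S x

  release : ∀ {S x} → Reachable S x →
            ∃ λ Q → role Q x ≡ uncovered × uncoveredCount Q ≡ uncoveredCount S ×
                    (∀ w → isAbsorbing (role Q w) ≡ isAbsorbing (role S w))
  release {S} (now ux) = S , ux , refl , λ _ → refl
  release {S} (after ux₀ x₀h fe r) with release r
  ... | Q , uQ , count-eq , absorbing-eq =
    Q , uQ , trans count-eq uncoveredCount-preserved ,
    λ w → trans (absorbing-eq w) (absorbing-preserved w)
    where open Exchange S ux₀ x₀h fe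

  reachable⇒absorbing : ∀ {S x} → Reachable S x → T (isAbsorbing (role S x))
  reachable⇒absorbing {S} {x} r with release r
  ... | Q , uQ , _ , absorbing-eq = subst T (absorbing-eq x) (roleAt (T ∘ isAbsorbing) uQ _)

  reachable-extend : ∀ {S x h a} → Reachable S x → Adj G h x → role S a ≡ end h → Reachable S a
  reachable-extend {S} (now ux) hx ea with consistentAt S ea
  ... | c , fe = after ux (Adj-sym G hx) fe (now (Exchange.ρ'a S ux (Adj-sym G hx) fe))
  reachable-extend {S} {a = a} (after {x₀ = x₀} {a = a'} {h = h'} ux₀ x₀h fe r) hx ea with a ≟ᶠ a'
  ... | yes refl = after ux₀ x₀h fe (now ρ'a)
    where open Exchange S ux₀ x₀h fe
  ... | no a≢a'  = after ux₀ x₀h fe (reachable-extend r hx (trans (ρ'-elsewhere a a≢x₀ a≢a' a≢h') ea))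
    where
    open Exchange S ux₀ x₀h fe
    a≢x₀ : a ≢ x₀
    a≢x₀ = roles-differ ea ux₀ λ ()
    a≢h' : a ≢ h'
    a≢h' = absorbing≢middle S (roleAt (T ∘ isAbsorbing) ea _) fe

  end? : ∀ R h → Dec (R ≡ end h)
  end? (end y)            h = map′ (cong end) (λ { refl → refl }) (y ≟ᶠ h)
  end? uncovered          h = no λ ()
  end? (paired _)         h = no λ ()
  end? (middle _ _)       h = no λ ()
  end? (lockedMiddle _ _) h = no λ ()
  end? (lockedEnd _)      h = no λ ()

  record Closure (S : PartialFactor) : Set where
    field
      member     : Fin n → Bool
      reachable  : ∀ {w} → T (member w) → Reachable S w
      uncovered⊆ : ∀ {w} → role S w ≡ uncovered → T (member w)
      closed     : ∀ {x h a} → T (member x) → Adj G h x → role S a ≡ end h → T (member a)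

  closure : (S : PartialFactor) → Closure S
  closure S = grow (suc n) (isUncovered ∘ role S)
                (λ {w} t → now (uncovered-at (role S w) t)) (λ ux → roleAt (T ∘ isUncovered) ux _)
                (m≤n+m (suc n) _)
    where
    Violation : (Fin n → Bool) → Set
    Violation D = ∃ λ x → T (D x) × ∃ λ h → Adj G h x × ∃ λ a → role S a ≡ end h × ¬ T (D a)

    violation? : ∀ D → Dec (Violation D)
    violation? D = any? λ x → T? (D x) ×-dec any? λ h → T? (adj G h x) ×-dec
                   any? λ a → end? (role S a) h ×-dec ¬? (T? (D a))

    grow : (fuel : ℕ) (D : Fin n → Bool) → (∀ {w} → T (D w) → Reachable S w) →
           (∀ {w} → role S w ≡ uncovered → T (D w)) → n < count D + fuel → Closure S
    grow fuel D reach unc bound with violation? D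
    ... | no none = record
      { member = D ; reachable = reach ; uncovered⊆ = unc
      ; closed = λ {x} {h} {a} Dx hx ea →
          decidable-stable (T? (D a)) λ ¬Da → none (x , Dx , h , hx , a , ea , ¬Da) }
    grow zero    D reach unc bound | yes _ =
      ⊥-elim (<⇒≱ (subst (n <_) (+-identityʳ (count D)) bound) (count≤n D))
    grow (suc fuel) D reach unc bound | yes (x , Dx , h , hx , a , ea , ¬Da) =
      grow fuel D' reach' (λ ux → D⊆D' (unc ux)) bound'
      where
      D' : Fin n → Bool
      D' w = D w ∨ ⌊ w ≟ᶠ a ⌋
      D⊆D' : ∀ {w} → T (D w) → T (D' w)
      D⊆D' = Equivalence.from T-∨ ∘ inj₁
      reach' : ∀ {w} → T (D' w) → Reachable S w
      reach' {w} t with Equivalence.to T-∨ t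
      ... | inj₁ Dw = reach Dw
      ... | inj₂ w≡a with toWitness {a? = w ≟ᶠ a} w≡a
      ...   | refl = reachable-extend (reach Dx) hx ea
      a∈D' : T (D' a)
      a∈D' = Equivalence.from T-∨ (inj₂ (fromWitness {a? = a ≟ᶠ a} refl))
      bound' : n < count D' + fuel
      bound' = ≤-trans bound (≤-trans (≤-reflexive (+-suc (count D) fuel))
                 (+-monoˡ-≤ fuel (count-mono-< (λ _ → D⊆D') a a∈D' ¬Da)))

  -- The counting argument

  freeEnds : Role → ℕ
  freeEnds (middle _ _)       = 2
  freeEnds (lockedMiddle _ _) = 1
  freeEnds _                  = 0

  isEnd isLockedMiddle isLockedEnd : Role → Bool
  isEnd (end _) = true
  isEnd _       = false
  isLockedMiddle (lockedMiddle _ _) = true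
  isLockedMiddle _                  = false
  isLockedEnd (lockedEnd _) = true
  isLockedEnd _             = false

  lockWeight : Role → ℕ
  lockWeight R = indicator (isLockedMiddle R) + 2 * indicator (isLockedEnd R)

  module _ (S : PartialFactor) where

    lockedMiddle-unique : ∀ u v → T (isLockedMiddle (role S u)) → T (isLockedMiddle (role S v)) → u ≡ v
    lockedMiddle-unique u v lu lv with role S u in eu | role S v in ev
    ... | lockedMiddle _ q | lockedMiddle _ _ with u ≟ᶠ v
    ...   | yes u≡v = u≡v
    ...   | no  u≢v = ⊥-elim $ roles-differ ev (lockedMiddle-other S eu) (λ ()) $
              UEdge-other (lockedMiddle-edge S eu) (lockedMiddle-edge S ev) u≢v

    lockedEnd-unique : ∀ u v → T (isLockedEnd (role S u)) → T (isLockedEnd (role S v)) → u ≡ v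
    lockedEnd-unique u v lu lv with role S u in eu | role S v in ev
    ... | lockedEnd y | lockedEnd y' with consistentAt S eu | consistentAt S ev | y ≟ᶠ y'
    ...   | _ , ey | _ , ey' | yes refl with trans (sym ey) ey'
    ...     | refl = refl
    lockedEnd-unique u v lu lv | lockedEnd y | lockedEnd y' | _ , ey | _ , ey' | no y≢y' =
      ⊥-elim $ roles-differ ey' eu (λ ()) $ UEdge-other (lockedMiddle-edge S ey) (lockedMiddle-edge S ey') y≢y'

  Spanning : PartialFactor → Set
  Spanning S = ∀ w → role S w ≢ uncovered

  module _ {r k : ℕ} (star-free : K1r-free G r) (min-degree : ∀ v → suc k ≤ count (adj G v)) where

    module Stuck (S : PartialFactor) (C : Closure S)
                 (stuck : ∀ {d z} → T (Closure.member C d) → Adj G d z → ¬ T (isAbsorbing (role S z)))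
                 {x₀ : Fin n} (ux₀ : role S x₀ ≡ uncovered) where

      open Closure C renaming (member to D)

      D-independent : ∀ {d d'} → T (D d) → T (D d') → ¬ Adj G d d'
      D-independent Dd Dd' dd' = stuck Dd dd' (reachable⇒absorbing (reachable Dd'))

      A : Fin n → Bool
      A w = ⌊ any? (λ d → T? (D d) ×-dec T? (adj G w d)) ⌋

      A-intro : ∀ {w d} → T (D d) → Adj G w d → T (A w)
      A-intro Dd wd = fromWitness (_ , Dd , wd)

      A-elim : ∀ {w} → T (A w) → ∃ λ d → T (D d) × Adj G w d
      A-elim = toWitness

      A-inner : ∀ {h} → T (A h) → ¬ T (isAbsorbing (role S h))
      A-inner t = let (d , Dd , hd) = A-elim t in stuck Dd (Adj-sym G hd)

      edges-bound : suc k * count D ≤ pred r * count A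
      edges-bound = begin
        suc k * count D                        ≡⟨ *-distribˡ-sum (suc k) (indicator ∘ D) ⟩
        sum (λ d → suc k * indicator (D d))    ≤⟨ double-counting (λ d w → D d ∧ adj G d w) row column ⟩
        sum (λ w → pred r * indicator (A w))   ≡⟨ *-distribˡ-sum (pred r) (indicator ∘ A) ⟨
        pred r * count A                       ∎
        where
        open ≤-Reasoning
        row : ∀ d → suc k * indicator (D d) ≤ count (λ w → D d ∧ adj G d w)
        row d with D d
        ... | false = ≤-trans (≤-reflexive (*-zeroʳ (suc k))) z≤n
        ... | true  = ≤-trans (≤-reflexive (*-identityʳ (suc k))) (min-degree d)
        column : ∀ w → count (λ d → D d ∧ adj G d w) ≤ pred r * indicator (A w)
        column w with A w in Aw
        ... | false = ≤-reflexive $ trans (count-none (λ d → D d ∧ adj G d w) λ d t →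
                let (Dd , dw) = Equivalence.to T-∧ t in subst T Aw (A-intro Dd (Adj-sym G dw)))
                (sym (*-zeroʳ (pred r)))
        ... | true with r ≤? count (λ d → D d ∧ adj G d w)
        ...   | no  few  =
          ≤-trans (suc[m]≤n⇒m≤pred[n] (≰⇒> few)) (≤-reflexive (sym (*-identityʳ (pred r))))
        ...   | yes many with distinct-witnesses _ many
        ...     | leaf , leaf-injective , leaf-adj = ⊥-elim $ star-free
                    ( w , leaf , leaf-injective , (λ i → Adj-sym G (proj₂ (Equivalence.to T-∧ (leaf-adj i))))
                    , λ i j → D-independent (proj₁ (Equivalence.to T-∧ (leaf-adj i)))
                                            (proj₁ (Equivalence.to T-∧ (leaf-adj j))))

      EndOf : Fin n → Fin n → Bool
      EndOf h d = D d ∧ ⌊ end? (role S d) h ⌋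

      EndOf-intro : ∀ {h d} → T (D d) → role S d ≡ end h → T (EndOf h d)
      EndOf-intro Dd ed = Equivalence.from T-∧ (Dd , fromWitness ed)

      EndOf-elim : ∀ {h d} → T (EndOf h d) → T (D d) × role S d ≡ end h
      EndOf-elim {h} {d} t = let (Dd , ed) = Equivalence.to (T-∧ {D d}) t in Dd , toWitness ed

      free-ends-bound : sum (λ h → if A h then freeEnds (role S h) else 0) < count D
      free-ends-bound = begin-strict
        sum (λ h → if A h then freeEnds (role S h) else 0)  ≤⟨ double-counting EndOf row column ⟩
        count (λ d → D d ∧ isEnd (role S d))               <⟨ count-mono-< (λ _ → proj₁ ∘ Equivalence.to T-∧)
                                                                x₀ (uncovered⊆ ux₀) x₀-not-end ⟩
        count D                                            ∎
        where
        open ≤-Reasoning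
        x₀-not-end : ¬ T (D x₀ ∧ isEnd (role S x₀))
        x₀-not-end t = roleAt (¬_ ∘ T ∘ isEnd) ux₀ id (proj₂ (Equivalence.to T-∧ t))
        row : ∀ h → (if A h then freeEnds (role S h) else 0) ≤ count (EndOf h)
        row h with A h in Ah
        ... | false = z≤n
        ... | true with A-elim (subst T (sym Ah) _) | role S h in eh
        ...   | d , Dd , hd | middle p q = let (_ , _ , p≢q , ep , eq) = consistentAt S eh in
                T²⇒1<count (EndOf h) p≢q (EndOf-intro (closed Dd hd ep) ep) (EndOf-intro (closed Dd hd eq) eq)
        ...   | d , Dd , hd | lockedMiddle p q = let (_ , _ , ep , _) = consistentAt S eh in
                T⇒0<count (EndOf h) (EndOf-intro (closed Dd hd ep) ep)
        ...   | _ | uncovered      = z≤n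
        ...   | _ | paired _       = z≤n
        ...   | _ | end _          = z≤n
        ...   | _ | lockedEnd _    = z≤n
        column : ∀ d → count (λ h → EndOf h d) ≤ indicator (D d ∧ isEnd (role S d))
        column d with D d ∧ isEnd (role S d) in d-end
        ... | true  = unique⇒count≤1 (λ h → EndOf h d) λ h h' t t' →
                        end-injective (trans (sym (proj₂ (EndOf-elim t))) (proj₂ (EndOf-elim t')))
          where
          end-injective : ∀ {y h} → end y ≡ end h → y ≡ h
          end-injective refl = refl
        ... | false = ≤-reflexive $ count-none (λ h → EndOf h d) λ h t →
                        let (Dd , ed) = EndOf-elim t in
                        subst T d-end (Equivalence.from T-∧ (Dd , roleAt (T ∘ isEnd) ed _))

      lock-bound : sum (lockWeight ∘ role S) ≤ 3
      lock-bound = begin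
        sum (lockWeight ∘ role S)
          ≡⟨ ∑-distrib-+ (indicator ∘ isLockedMiddle ∘ role S) (λ h → 2 * indicator (isLockedEnd (role S h))) ⟩
        count (isLockedMiddle ∘ role S) + sum (λ h → 2 * indicator (isLockedEnd (role S h)))
          ≡⟨ cong (count (isLockedMiddle ∘ role S) +_) (*-distribˡ-sum 2 (indicator ∘ isLockedEnd ∘ role S)) ⟨
        count (isLockedMiddle ∘ role S) + 2 * count (isLockedEnd ∘ role S)
          ≤⟨ +-mono-≤ (unique⇒count≤1 _ (lockedMiddle-unique S))
                      (*-monoʳ-≤ 2 (unique⇒count≤1 _ (lockedEnd-unique S))) ⟩
        3 ∎
        where open ≤-Reasoning

      -- A vertex of A is not absorbing: it is a middle, with its free ends in D, or locked.
      ends-bound : 2 * count A ≤ count D + 2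
      ends-bound = +-cancelʳ-≤ 1 _ _ $ begin
        2 * count A + 1                              ≡⟨ cong (_+ 1) (*-distribˡ-sum 2 (indicator ∘ A)) ⟩
        sum (λ h → 2 * indicator (A h)) + 1          ≤⟨ +-monoˡ-≤ 1 (∑-mono-≤ pointwise) ⟩
        sum (λ h → F h + lockWeight (role S h)) + 1  ≡⟨ cong (_+ 1) (∑-distrib-+ F (lockWeight ∘ role S)) ⟩
        sum F + sum (lockWeight ∘ role S) + 1        ≡⟨ regroup (sum F) _ ⟩
        suc (sum F) + sum (lockWeight ∘ role S)      ≤⟨ +-mono-≤ free-ends-bound lock-bound ⟩
        count D + 3                                  ≡⟨ +-assoc (count D) 2 1 ⟨
        count D + 2 + 1                              ∎
        where
        open ≤-Reasoning
        F : Fin n → ℕ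
        F h = if A h then freeEnds (role S h) else 0
        regroup : ∀ f l → f + l + 1 ≡ suc f + l
        regroup = solve-∀
        pointwise : ∀ h → 2 * indicator (A h) ≤ F h + lockWeight (role S h)
        pointwise h with A h in Ah
        ... | false = z≤n
        ... | true with role S h in eh
        ...   | middle _ _       = ≤-refl
        ...   | lockedMiddle _ _ = ≤-refl
        ...   | lockedEnd _      = ≤-refl
        ...   | uncovered = ⊥-elim (A-inner (subst T (sym Ah) _) (roleAt (T ∘ isAbsorbing) eh _))
        ...   | paired _  = ⊥-elim (A-inner (subst T (sym Ah) _) (roleAt (T ∘ isAbsorbing) eh _))
        ...   | end _     = ⊥-elim (A-inner (subst T (sym Ah) _) (roleAt (T ∘ isAbsorbing) eh _))

      neighbourhood-large : suc k ≤ count A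
      neighbourhood-large = ≤-trans (min-degree x₀) $
        count-mono {p = adj G x₀} {q = A} λ w x₀w → A-intro (uncovered⊆ ux₀) (Adj-sym G x₀w)

      impossible : pred r < k + k → ⊥
      impossible = degree-counting-absurd k (pred r) (count A) (count D) edges-bound ends-bound neighbourhood-large

    augment : pred r < k + k → (S : PartialFactor) {x₀ : Fin n} → role S x₀ ≡ uncovered → Improvement S
    augment r<2k S ux₀ = by-cases (any? absorbing-neighbour?)
      where
      open Closure (closure S) renaming (member to D)
      AbsorbingNeighbour : Fin n → Set
      AbsorbingNeighbour d = T (D d) × ∃ λ z → Adj G d z × T (isAbsorbing (role S z))
      absorbing-neighbour? : ∀ d → Dec (AbsorbingNeighbour d)
      absorbing-neighbour? d = T? (D d) ×-dec any? λ z → T? (adj G d z) ×-dec T? (isAbsorbing (role S z))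
      by-cases : Dec (∃ AbsorbingNeighbour) → Improvement S
      by-cases (yes (d , Dd , z , dz , z-absorbing)) =
        let (Q , ud , count-eq , absorbing-eq) = release (reachable Dd)
            (S' , S'<Q) = attach Q ud dz (subst T (sym (absorbing-eq z)) z-absorbing)
        in S' , subst (uncoveredCount S' <_) count-eq S'<Q
      by-cases (no none) = ⊥-elim $
        Stuck.impossible S (closure S) (λ Dd dz za → none (_ , Dd , _ , dz , za)) ux₀ r<2k

    saturate : pred r < k + k → (fuel : ℕ) (S : PartialFactor) → uncoveredCount S ≤ fuel → ∃ Spanning
    saturate r<2k fuel S bound with any? (λ w → T? (isUncovered (role S w)))
    ... | no none = S , λ w uw → none (w , roleAt (T ∘ isUncovered) uw _)
    ... | yes (x₀ , t) with fuel | augment r<2k S (uncovered-at (role S x₀) t)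
    ...   | zero     | _         = ⊥-elim (<⇒≱ (T⇒0<count (isUncovered ∘ role S) t) bound)
    ...   | suc fuel | S' , S'<S = saturate r<2k fuel S' (≤-pred (≤-trans S'<S bound))

  -- From a spanning partial factor to a factor

  module Extraction (S : PartialFactor) (spanning : Spanning S) where

    piecesAt : Fin n → Role → List (Piece n)
    piecesAt v (paired b)         = if ⌊ v <ᶠ? b ⌋ then p2 v b ∷ [] else []
    piecesAt v (middle a c)       = p3 a v c ∷ []
    piecesAt v (lockedMiddle a c) = p3 a v c ∷ []
    piecesAt v _                  = []

    piecesOf : Fin n → List (Piece n)
    piecesOf v = piecesAt v (role S v)

    block : Fin n → List (Fin n)
    block v = concatMap verts (piecesOf v)

    ownerAt : Fin n → Role → Fin n
    ownerAt w (paired b)    = if ⌊ w <ᶠ? b ⌋ then w else b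
    ownerAt w (end y)       = y
    ownerAt w (lockedEnd y) = y
    ownerAt w _             = w

    owner : Fin n → Fin n
    owner w = ownerAt w (role S w)

    module _ {v b : Fin n} (v<b : v <ᶠ b) where

      smaller-emits : piecesAt v (paired b) ≡ p2 v b ∷ []
      smaller-emits with v <ᶠ? b
      ... | yes _   = refl
      ... | no v≮b = ⊥-elim (v≮b v<b)

      smaller-owns : ownerAt v (paired b) ≡ v
      smaller-owns with v <ᶠ? b
      ... | yes _   = refl
      ... | no v≮b = ⊥-elim (v≮b v<b)

      larger-owned : ownerAt b (paired v) ≡ v
      larger-owned with b <ᶠ? v
      ... | yes b<v = ⊥-elim (<-asymᶠ v<b b<v)
      ... | no _    = refl

    paired-ordered : ∀ {v b} → role S v ≡ paired b → v <ᶠ b ⊎ b <ᶠ v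
    paired-ordered {v} {b} ev with <-cmpᶠ v b
    ... | tri< v<b _ _ = inj₁ v<b
    ... | tri≈ _ v≡b _ = ⊥-elim (Adj⇒≢ G (proj₁ (consistentAt S ev)) v≡b)
    ... | tri> _ _ b<v = inj₂ b<v

    piecesOf-at : ∀ {v R} → role S v ≡ R → piecesOf v ≡ piecesAt v R
    piecesOf-at = cong (piecesAt _)

    owner-at : ∀ {w R} → role S w ≡ R → owner w ≡ ownerAt w R
    owner-at = cong (ownerAt _)

    owned : ∀ v {x} → x ∈ block v → owner x ≡ v
    owned v {x} x∈ with role S v in ev
    ... | middle a c with x∈
    ...   | here refl                 = let (_ , _ , _ , ea , _) = consistentAt S ev in owner-at ea
    ...   | there (here refl)         = owner-at ev
    ...   | there (there (here refl)) = let (_ , _ , _ , _ , ec) = consistentAt S ev in owner-at ec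
    owned v {x} x∈ | lockedMiddle a c with x∈
    ...   | here refl                 = let (_ , _ , ea , _) = consistentAt S ev in owner-at ea
    ...   | there (here refl)         = owner-at ev
    ...   | there (there (here refl)) = owner-at (lockedMiddle-other S ev)
    owned v {x} x∈ | paired b with v <ᶠ? b | x∈
    ...   | yes v<b | here refl         = trans (owner-at ev) (smaller-owns v<b)
    ...   | yes v<b | there (here refl) = trans (owner-at (proj₂ (consistentAt S ev))) (larger-owned v<b)

    covers : ∀ x → x ∈ block (owner x)
    covers x with role S x in ex
    ... | uncovered = ⊥-elim (spanning x ex)
    ... | middle a c       rewrite piecesOf-at ex = there (here refl)
    ... | lockedMiddle a c rewrite piecesOf-at ex = there (here refl)
    ... | end y with consistentAt S ex
    ...   | c , first  ey rewrite piecesOf-at ey = here refl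
    ...   | c , second ey rewrite piecesOf-at ey = there (there (here refl))
    ...   | c , locked ey rewrite piecesOf-at ey = here refl
    covers x | lockedEnd y with consistentAt S ex
    ...   | a , ey rewrite piecesOf-at ey = there (there (here refl))
    covers x | paired b with paired-ordered ex
    ...   | inj₁ x<b rewrite smaller-owns x<b | piecesOf-at ex | smaller-emits x<b = here refl
    ...   | inj₂ b<x rewrite larger-owned b<x | piecesOf-at (proj₂ (consistentAt S ex)) | smaller-emits b<x =
      there (here refl)

    block-unique : ∀ v → Unique (block v)
    block-unique v with role S v in ev
    ... | middle a c = let (av , vc , a≢c , _) = consistentAt S ev in
          three-distinct (Adj⇒≢ G av) a≢c (Adj⇒≢ G vc)
    ... | lockedMiddle a c = let (av , vc , ea , ec , _) = consistentAt S ev in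
          three-distinct (Adj⇒≢ G av) (roles-differ ea ec λ ()) (Adj⇒≢ G vc)
    ... | paired b with v <ᶠ? b
    ...   | yes _ = (Adj⇒≢ G (proj₁ (consistentAt S ev)) ∷ []) ∷ [] ∷ []
    ...   | no  _ = []
    block-unique v | uncovered   = []
    block-unique v | end _       = []
    block-unique v | lockedEnd _ = []

    pieces-in-G : ∀ {p} → p ∈ concatMap piecesOf (allFin n) → PieceInG G p
    pieces-in-G p∈ with find (∈-concatMap⁻ piecesOf {xs = allFin n} p∈)
    ... | v , _ , p∈v with role S v in ev
    ...   | middle a c       with p∈v
    ...     | here refl = let (av , vc , _) = consistentAt S ev in av , vc
    pieces-in-G p∈ | v , _ , p∈v | lockedMiddle a c with p∈v
    ...     | here refl = let (av , vc , _) = consistentAt S ev in av , vc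
    pieces-in-G p∈ | v , _ , p∈v | paired b with v <ᶠ? b | p∈v
    ...     | yes _ | here refl = proj₁ (consistentAt S ev)

    factor : P23Factor G
    factor = record
      { pieces   = concatMap piecesOf (allFin n)
      ; inG      = pieces-in-G
      ; spanning = subst (_↭ allFin n) (sym (concatMap-concatMap verts piecesOf (allFin n)))
                     (concatMap-partition-↭ block owner block-unique owned covers)
      }

    piece-at : ∀ {v R p} → role S v ≡ R → p ∈ piecesAt v R → p ∈ pieces factor
    piece-at {v} ev p∈ = ∈-concatMap⁺ piecesOf (lose (∈-allFin v) (subst (_ ∈_) (sym (piecesOf-at ev)) p∈))

    contains : FactorContains factor e₁ e₂
    contains with keepsEdge S
    ... | v , carries with role S v in ev
    ...   | lockedMiddle a c = p3 a v c , piece-at ev (here refl) , inj₂ (UEdge-swap carries)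
    ...   | paired b with paired-ordered ev
    ...     | inj₁ v<b = p2 v b , piece-at ev (subst (_ ∈_) (sym (smaller-emits v<b)) (here refl)) ,
                         UEdge-swap carries
    ...     | inj₂ b<v = p2 b v ,
                         piece-at (proj₂ (consistentAt S ev)) (subst (_ ∈_) (sym (smaller-emits b<v)) (here refl)) ,
                         UEdge-swap (UEdge-flip carries)

theorem11 : (r n : ℕ) → 3 ≤ r → (G : Graph n) → K1r-free G r →
            MinDegreeAtLeast G (⌈ r /2⌉ + 1) → P23FactorCovered G
theorem11 r n 3≤r G star-free δ≥ x y xy = factor , contains
  where
  open PartialFactors G x y
  min-degree : ∀ v → suc ⌈ r /2⌉ ≤ count (adj G v)
  min-degree v = subst₂ _≤_ (+-comm ⌈ r /2⌉ 1) (degree≡count G v) (δ≥ v)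
  saturated : ∃ Spanning
  saturated =
    saturate star-free min-degree (pred<⌈/2⌉+⌈/2⌉ (≤-trans (s≤s z≤n) 3≤r)) _ (initial xy) ≤-refl
  open Extraction (proj₁ saturated) (proj₂ saturated)
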